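{- Let $G$ be a graph and $A \in \mathcal{S}(G)$. Suppose $\alpha \subseteq V(G)$ is a subset of vertices such that $A[\alpha]$ is invertible and $A/A[\alpha] \in \mathcal{S}(H)$ for some graph $H$ (on vertex set $V(G)\setminus\alpha$) in which $N(\alpha)$ is a clique. Then: if $A$ has SAP, then $A/A[\alpha]$ has SAP; and for any given $i \notin \alpha$, if $A$ has $i$-SNIP, then $A/A[\alpha]$ has $i$-SNIP.
   Context: All graphs are finite and simple. For a graph $G$ with vertices labeled $1,\dots,n$, $\mathcal{S}(G)$ is the set of $n\times n$ real symmetric matrices whose off-diagonal $(p,q)$-entry is nonzero iff $\{p,q\}\in E(G)$ (diagonal arbitrary). $N(\alpha) = \bigcup_{v\in\alpha}N(v)\setminus\alpha$, with $N(v)$ the neighborhood of $v$ in $G$. $A[\alpha]$ is the principal submatrix on $\alpha$; writing $A = \begin{bmatrix} Q & B^\top \\ B & C\end{bmatrix}$ with $Q = A[\alpha]$, the Schur complement is $A/Q = C - BQ^{ -1}B^\top$ (indexed by $V(G)\setminus\alpha$). $\circ$ is the entrywise product; $(MX)(i,:]$ is $MX$ with row $i$ deleted. A symmetric $M$ has the Strong Arnold Property (SAP) if the only symmetric $X$ with $M\circ X=O$, $I\circ X=O$, $MX=O$ is $X=O$; it has $i$-SNIP if the only symmetric $X$ with $M\circ X=O$, $I\circ X=O$, $(MX)(i,:]=O$ is $X=O$. -}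

module Defs where

open import Level using (Level; _⊔_) renaming (suc to lsuc)
open import Data.Nat using (ℕ; zero; suc)
open import Data.Fin using (Fin; zero; suc)
open import Data.Product using (Σ; ∃; _×_; _,_)
open import Data.Sum using (_⊎_)
open import Relation.Nullary using (¬_)
open import Relation.Binary.PropositionalEquality using (_≡_; _≢_)
open import Function.Bundles using (_⇔_)
open import Algebra.Bundles using (CommutativeRing)

-- The real numbers, axiomatised as a complete ordered field.
-- (Any two such structures are isomorphic, so quantifying over every
-- complete ordered field is the same as speaking about ℝ.)

record CompleteOrderedField c ℓ : Set (lsuc (c ⊔ ℓ)) where
  field
    commRing : CommutativeRing c ℓ
  open CommutativeRing commRing public hiding (refl; sym; trans; zero)
  field
    0≉1     : ¬ (0# ≈ 1#)
    inverse : ∀ x → ¬ (x ≈ 0#) → Σ Carrier λ y → x * y ≈ 1#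
    _≤_       : Carrier → Carrier → Set ℓ
    ≤-resp-≈  : ∀ {x x' y y'} → x ≈ x' → y ≈ y' → x ≤ y → x' ≤ y'
    ≤-refl    : ∀ {x} → x ≤ x
    ≤-trans   : ∀ {x y z} → x ≤ y → y ≤ z → x ≤ z
    ≤-antisym : ∀ {x y} → x ≤ y → y ≤ x → x ≈ y
    ≤-total   : ∀ x y → x ≤ y ⊎ y ≤ x
    +-mono-≤  : ∀ {x y} z → x ≤ y → (x + z) ≤ (y + z)
    *-nonneg  : ∀ {x y} → 0# ≤ x → 0# ≤ y → 0# ≤ (x * y)
    lub : (P : Carrier → Set (c ⊔ ℓ)) →
          (∃ λ x → P x) →
          (∃ λ b → ∀ x → P x → x ≤ b) →
          ∃ λ s → (∀ x → P x → x ≤ s) × (∀ b → (∀ x → P x → x ≤ b) → s ≤ b)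

record Graph (n : ℕ) : Set₁ where
  field
    Adj     : Fin n → Fin n → Set
    sym     : ∀ {p q} → Adj p q → Adj q p
    irrefl  : ∀ p → ¬ Adj p p

module LinAlg {c ℓ : Level} (ℝ : CompleteOrderedField c ℓ) where
  open CompleteOrderedField ℝ

  Matrix : ℕ → ℕ → Set c
  Matrix m n = Fin m → Fin n → Carrier

  ∑ : ∀ {k} → (Fin k → Carrier) → Carrier
  ∑ {zero}  f = 0#
  ∑ {suc k} f = f zero + ∑ (λ i → f (suc i))

  _⊗_ : ∀ {m k n} → Matrix m k → Matrix k n → Matrix m n
  (M ⊗ N) i j = ∑ λ t → M i t * N t j

  _ᵀ : ∀ {m n} → Matrix m n → Matrix n m
  (M ᵀ) i j = M j i

  Id : ∀ {n} → Matrix n n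
  Id {suc n} zero    zero    = 1#
  Id {suc n} zero    (suc j) = 0#
  Id {suc n} (suc i) zero    = 0#
  Id {suc n} (suc i) (suc j) = Id i j

  _≈ₘ_ : ∀ {m n} → Matrix m n → Matrix m n → Set ℓ
  M ≈ₘ N = ∀ i j → M i j ≈ N i j

  Symmetric : ∀ {n} → Matrix n n → Set ℓ
  Symmetric M = ∀ i j → M i j ≈ M j i

  InS : ∀ {n} → Graph n → Matrix n n → Set ℓ
  InS {n} G A = Symmetric A ×
    (∀ p q → p ≢ q → ((¬ (A p q ≈ 0#)) ⇔ Graph.Adj G p q))

  IsInverse : ∀ {k} → Matrix k k → Matrix k k → Set ℓ
  IsInverse Q Q' = ((Q ⊗ Q') ≈ₘ Id) × ((Q' ⊗ Q) ≈ₘ Id)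

  sub : ∀ {n m k} → Matrix n n → (Fin m → Fin n) → (Fin k → Fin n) → Matrix m k
  sub A r s i j = A (r i) (s j)

  -- Schur complement A / A[α] = C - B Q⁻¹ Bᵀ, where α is enumerated by ι,
  -- V(G) \ α by κ, and Q' is the inverse of Q = A[α].
  schur : ∀ {n k m} → Matrix n n → (Fin k → Fin n) → (Fin m → Fin n) →
          Matrix k k → Matrix m m
  schur A ι κ Q' i j =
    sub A κ κ i j - ((sub A κ ι ⊗ Q') ⊗ sub A ι κ) i j

  SAP : ∀ {n} → Matrix n n → Set (c ⊔ ℓ)
  SAP {n} M = (X : Matrix n n) → Symmetric X →
    (∀ p q → M p q * X p q ≈ 0#) →
    (∀ p → X p p ≈ 0#) →
    (∀ p q → (M ⊗ X) p q ≈ 0#) →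
    ∀ p q → X p q ≈ 0#

  SNIP : ∀ {n} → Fin n → Matrix n n → Set (c ⊔ ℓ)
  SNIP {n} i M = (X : Matrix n n) → Symmetric X →
    (∀ p q → M p q * X p q ≈ 0#) →
    (∀ p → X p p ≈ 0#) →
    (∀ p q → p ≢ i → (M ⊗ X) p q ≈ 0#) →
    ∀ p q → X p q ≈ 0#

{-# OPTIONS --safe #-}
-- Split A along α and its complement as [Q Bᵀ; B C], so that S = A/A[α] = C − B Q⁻¹ Bᵀ, and let
-- X be symmetric with S ∘ X = O and I ∘ X = O. Put W = Q⁻¹ Bᵀ X and Y = [O, −W; −Wᵀ, X]; then Y is
-- symmetric with zero diagonal, QW = BᵀX and BW = (C − S) X.
-- The clique hypothesis makes every product B_ba B_b′a′ X_bb′ vanish: if both entries of B are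
-- nonzero then b, b′ ∈ N(α), so b = b′ or S_bb′ ≠ 0, and X_bb′ = 0 either way. Summing such
-- products gives BᵀXB = O and C ∘ X = S ∘ X = O, hence A ∘ Y = O and C Wᵀ = S X B Q⁻ᵀ.
-- So the rows of AY indexed by α vanish and the row indexed by b ∉ α is (−(SX)_b B Q⁻ᵀ, (SX)_b):
-- Y meets the SAP (i-SNIP) conditions for A whenever X meets them for S, and Y = O forces X = O.
-- Constructively B_ba ≠ 0 cannot be decided; the case split is justified by ¬¬-stability of
-- x ≈ 0, which follows from the Archimedean property of a complete ordered field.
module Submission where

open import Defs
open import Data.Fin using (Fin)
open import Data.Product using (∃; _×_)
open import Data.Sum using (_⊎_)
open import Relation.Binary.PropositionalEquality using (_≡_; _≢_)
open import Function.Definitions using (Injective)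

open import Level using (Lift; lift; _⊔_)
open import Data.Nat as ℕ using (ℕ; zero; suc)
open import Data.Fin using (zero; suc; _≟_; splitAt; join)
open import Data.Fin.Properties using (splitAt-join; join-splitAt)
open import Data.Fin.Permutation using (Permutation; permutation)
open import Data.Product using (_,_; proj₁; proj₂)
open import Data.Sum using (inj₁; inj₂; [_,_]′; map₁)
open import Data.Unit using (⊤; tt)
open import Function using (_∘_; flip; Equivalence)
open import Algebra.Bundles using (CommutativeRing)
open import Relation.Nullary using (¬_; yes; no; contradiction)
open import Relation.Nullary.Negation using (Stable; ¬¬-map)
open import Relation.Binary.PropositionalEquality as ≡ using (subst)
import Algebra.Properties.Ring as RingProperties
import Algebra.Properties.CommutativeSemigroup as CommutativeSemigroupProperties
import Algebra.Properties.Semiring.Sum as SemiringSum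
import Algebra.Properties.Monoid.Mult as MonoidMult
import Relation.Binary.Reasoning.Setoid as SetoidReasoning

record Partition (n k m : ℕ) : Set where
  field
    ι           : Fin k → Fin n
    κ           : Fin m → Fin n
    ι-injective : Injective _≡_ _≡_ ι
    κ-injective : Injective _≡_ _≡_ κ
    disjoint    : ∀ a b → ι a ≢ κ b
    cover       : ∀ v → (∃ λ a → ι a ≡ v) ⊎ (∃ λ b → κ b ≡ v)

  embed : Fin k ⊎ Fin m → Fin n
  embed = [ ι , κ ]′

  classify : Fin n → Fin k ⊎ Fin m
  classify v = Data.Sum.map proj₁ proj₁ (cover v)

  embed-classify : ∀ v → embed (classify v) ≡ v
  embed-classify v with cover v
  ... | inj₁ (_ , ιa≡v) = ιa≡v
  ... | inj₂ (_ , κb≡v) = κb≡v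

  classify-embed : ∀ s → classify (embed s) ≡ s
  classify-embed (inj₁ a) with cover (ι a)
  ... | inj₁ (_ , ιa′≡ιa) = ≡.cong inj₁ (ι-injective ιa′≡ιa)
  ... | inj₂ (b , κb≡ιa) = contradiction (≡.sym κb≡ιa) (disjoint a b)
  classify-embed (inj₂ b) with cover (κ b)
  ... | inj₁ (a , ιa≡κb) = contradiction ιa≡κb (disjoint a b)
  ... | inj₂ (_ , κb′≡κb) = ≡.cong inj₂ (κ-injective κb′≡κb)

  ∀-embed : ∀ {p} {F : Fin n → Set p} → (∀ s → F (embed s)) → ∀ v → F v
  ∀-embed {F = F} f v = subst F (embed-classify v) (f (classify v))

  ∀-embed₂ : ∀ {p} {F : Fin n → Fin n → Set p} →
             (∀ s t → F (embed s) (embed t)) → ∀ u v → F u v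
  ∀-embed₂ {F = F} f = ∀-embed {F = λ u → ∀ v → F u v} (λ s → ∀-embed (f s))

  ⊎-permutation : Permutation (k ℕ.+ m) n
  ⊎-permutation = permutation (embed ∘ splitAt k) (join k m ∘ classify)
    (λ v → ≡.trans (≡.cong embed (splitAt-join k m (classify v))) (embed-classify v))
    (λ i → ≡.trans (≡.cong (join k m) (classify-embed (splitAt k i))) (join-splitAt k m i))

  InN[α] : Graph n → Fin m → Set
  InN[α] G b = ∃ λ a → Graph.Adj G (ι a) (κ b)

  NeighbourhoodIsClique : Graph n → Graph m → Set
  NeighbourhoodIsClique G H = ∀ b b′ → b ≢ b′ →
    InN[α] G b → InN[α] G b′ → Graph.Adj H b b′

module _ {c ℓ} (ℝ : CompleteOrderedField c ℓ) where
  open CompleteOrderedField ℝ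
  open LinAlg ℝ
  open CommutativeRing commRing using (refl; sym; trans)
  open RingProperties ring
    using (-1*x≈-x; -‿involutive; -0#≈0#; -‿+-comm; -‿distribʳ-*; [y-z]x≈yx-zx;
           //-rightDividesˡ; //-rightDividesʳ; \\-leftDividesˡ; ⁻¹-anti-homo‿-)
  open CommutativeSemigroupProperties *-commutativeSemigroup
    using (x∙yz≈y∙xz; x∙yz≈yx∙z; x∙yz≈xz∙y; xy∙z≈y∙xz)
  open SemiringSum semiring
    using (sum; sum-cong-≋; sum-replicate; sum-replicate-zero; sum-permute;
           *-distribˡ-sum; *-distribʳ-sum)
    renaming (∑-distrib-+ to sum-distrib-+; ∑-comm to sum-comm)
  open MonoidMult +-monoid using (×-congʳ) renaming (_×_ to _·_)
  open SetoidReasoning setoid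

  0≤1 : 0# ≤ 1#
  0≤1 with ≤-total 0# 1#
  ... | inj₁ 0≤1 = 0≤1
  ... | inj₂ 1≤0 = ≤-resp-≈ refl -1*-1≈1 (*-nonneg 0≤-1 0≤-1)
    where
    0≤-1 : 0# ≤ (- 1#)
    0≤-1 = ≤-resp-≈ (-‿inverseʳ 1#) (+-identityˡ (- 1#)) (+-mono-≤ (- 1#) 1≤0)
    -1*-1≈1 : - 1# * - 1# ≈ 1#
    -1*-1≈1 = trans (-1*x≈-x (- 1#)) (-‿involutive 1#)

  -- If s is the supremum of the multiples of x, then s - x bounds them as well, so s ≤ s - x.
  archimedean : ∀ {x} → (∀ n → (n · x) ≤ 1#) → x ≤ 0#
  archimedean {x} multiples≤1 = x≤0 (lub Multiple (0# , lift (0 , refl)) (1# , bounded))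
    where
    Multiple : Carrier → Set (c ⊔ ℓ)
    Multiple y = Lift c (∃ λ n → y ≈ n · x)

    bounded : ∀ y → Multiple y → y ≤ 1#
    bounded y (lift (n , y≈nx)) = ≤-resp-≈ (sym y≈nx) refl (multiples≤1 n)

    x≤0 : (∃ λ s → (∀ y → Multiple y → y ≤ s) ×
                   (∀ b → (∀ y → Multiple y → y ≤ b) → s ≤ b)) →
          x ≤ 0#
    x≤0 (s , s-bounds , s-least) = ≤-resp-≈ s+[x-s]≈x s-x+[x-s]≈0 (+-mono-≤ (x - s) s≤s-x)
      where
      s-x-bounds : ∀ y → Multiple y → y ≤ (s - x)
      s-x-bounds y (lift (n , y≈nx)) = ≤-resp-≈ (//-rightDividesʳ x y) refl
        (+-mono-≤ (- x) (s-bounds (y + x) (lift (suc n , trans (+-comm y x) (+-congˡ y≈nx)))))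
      s≤s-x : s ≤ (s - x)
      s≤s-x = s-least (s - x) s-x-bounds
      s+[x-s]≈x : s + (x - s) ≈ x
      s+[x-s]≈x = trans (+-congˡ (+-comm x (- s))) (\\-leftDividesˡ s x)
      s-x+[x-s]≈0 : s - x + (x - s) ≈ 0#
      s-x+[x-s]≈0 = trans (+-congˡ (sym (⁻¹-anti-homo‿- s x))) (-‿inverseʳ (s - x))

  multiples≤1 : ∀ {x} → ¬ ¬ (x ≈ 0#) → ∀ n → (n · x) ≤ 1#
  multiples≤1 {x} ¬¬x≈0 n with ≤-total (n · x) 1#
  ... | inj₁ nx≤1 = nx≤1
  ... | inj₂ 1≤nx = contradiction (λ x≈0 → 0≉1 (≤-antisym 0≤1 (1≤0 x≈0))) ¬¬x≈0
    where
    nx≈0 : x ≈ 0# → n · x ≈ 0#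
    nx≈0 x≈0 = trans (×-congʳ n x≈0) (trans (sym (sum-replicate n)) (sum-replicate-zero n))
    1≤0 : x ≈ 0# → 1# ≤ 0#
    1≤0 x≈0 = ≤-resp-≈ refl (nx≈0 x≈0) 1≤nx

  -‿≈0 : ∀ {x} → x ≈ 0# → - x ≈ 0#
  -‿≈0 x≈0 = trans (-‿cong x≈0) -0#≈0#

  ≈0-stable : ∀ x → Stable (x ≈ 0#)
  ≈0-stable x ¬¬x≈0 = ≤-antisym (archimedean (multiples≤1 ¬¬x≈0)) 0≤x
    where
    0≤x : 0# ≤ x
    0≤x = ≤-resp-≈ (-‿inverseˡ x) (+-identityˡ x)
      (+-mono-≤ x (archimedean (multiples≤1 (¬¬-map -‿≈0 ¬¬x≈0))))

  x*y≈0⇒y≈0 : ∀ {x y} → x ≉ 0# → x * y ≈ 0# → y ≈ 0#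
  x*y≈0⇒y≈0 {x} {y} x≉0 xy≈0 with inverse x x≉0
  ... | x⁻¹ , xx⁻¹≈1 = begin
    y                ≈⟨ *-identityˡ y ⟨
    1# * y           ≈⟨ *-congʳ xx⁻¹≈1 ⟨
    (x * x⁻¹) * y    ≈⟨ xy∙z≈y∙xz x x⁻¹ y ⟩
    x⁻¹ * (x * y)    ≈⟨ *-congˡ xy≈0 ⟩
    x⁻¹ * 0#         ≈⟨ zeroʳ x⁻¹ ⟩
    0#               ∎

  x*y*z≈0 : ∀ {x y z} → (x ≉ 0# → y ≉ 0# → z ≈ 0#) → (x * y) * z ≈ 0#
  x*y*z≈0 {x} {y} {z} z≈0 = ≈0-stable _ λ xyz≉0 →
    xyz≉0 (trans (*-congˡ (z≈0 (xyz≉0 ∘ x≈0⇒xyz≈0) (xyz≉0 ∘ y≈0⇒xyz≈0))) (zeroʳ _))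
    where
    x≈0⇒xyz≈0 : x ≈ 0# → (x * y) * z ≈ 0#
    x≈0⇒xyz≈0 x≈0 = trans (*-congʳ (trans (*-congʳ x≈0) (zeroˡ y))) (zeroˡ z)
    y≈0⇒xyz≈0 : y ≈ 0# → (x * y) * z ≈ 0#
    y≈0⇒xyz≈0 y≈0 = trans (*-congʳ (trans (*-congˡ y≈0) (zeroʳ x))) (zeroˡ z)

  ∑≡sum : ∀ {k} (f : Fin k → Carrier) → ∑ f ≡ sum f
  ∑≡sum {zero}  f = ≡.refl
  ∑≡sum {suc k} f = ≡.cong (f zero +_) (∑≡sum (f ∘ suc))

  ∑-cong : ∀ {k} {f g : Fin k → Carrier} → (∀ i → f i ≈ g i) → ∑ f ≈ ∑ g
  ∑-cong {f = f} {g} f≈g = begin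
    ∑ f    ≡⟨ ∑≡sum f ⟩
    sum f  ≈⟨ sum-cong-≋ f≈g ⟩
    sum g  ≡⟨ ∑≡sum g ⟨
    ∑ g    ∎

  ∑-zero : ∀ {k} {f : Fin k → Carrier} → (∀ i → f i ≈ 0#) → ∑ f ≈ 0#
  ∑-zero {k} {f} f≈0 = begin
    ∑ f                  ≈⟨ ∑-cong f≈0 ⟩
    ∑ {k} (λ _ → 0#)     ≡⟨ ∑≡sum {k} (λ _ → 0#) ⟩
    sum {k} (λ _ → 0#)   ≈⟨ sum-replicate-zero k ⟩
    0#                   ∎

  *-distribˡ-∑ : ∀ {k} x (f : Fin k → Carrier) → x * ∑ f ≈ ∑ (λ i → x * f i)
  *-distribˡ-∑ x f = begin
    x * ∑ f                ≡⟨ ≡.cong (x *_) (∑≡sum f) ⟩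
    x * sum f              ≈⟨ *-distribˡ-sum x f ⟩
    sum (λ i → x * f i)    ≡⟨ ∑≡sum (λ i → x * f i) ⟨
    ∑ (λ i → x * f i)      ∎

  *-distribʳ-∑ : ∀ {k} x (f : Fin k → Carrier) → ∑ f * x ≈ ∑ (λ i → f i * x)
  *-distribʳ-∑ x f = begin
    ∑ f * x                ≡⟨ ≡.cong (_* x) (∑≡sum f) ⟩
    sum f * x              ≈⟨ *-distribʳ-sum x f ⟩
    sum (λ i → f i * x)    ≡⟨ ∑≡sum (λ i → f i * x) ⟨
    ∑ (λ i → f i * x)      ∎

  ∑-distrib-+ : ∀ {k} (f g : Fin k → Carrier) → ∑ (λ i → f i + g i) ≈ ∑ f + ∑ g
  ∑-distrib-+ f g = begin
    ∑ (λ i → f i + g i)    ≡⟨ ∑≡sum (λ i → f i + g i) ⟩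
    sum (λ i → f i + g i)  ≈⟨ sum-distrib-+ f g ⟩
    sum f + sum g          ≡⟨ ≡.cong₂ _+_ (∑≡sum f) (∑≡sum g) ⟨
    ∑ f + ∑ g              ∎

  ∑-comm : ∀ {k l} (f : Fin k → Fin l → Carrier) →
           ∑ (λ i → ∑ (f i)) ≈ ∑ (λ j → ∑ (λ i → f i j))
  ∑-comm f = begin
    ∑ (λ i → ∑ (f i))                ≈⟨ ∑-cong (λ i → reflexive (∑≡sum (f i))) ⟩
    ∑ (λ i → sum (f i))              ≡⟨ ∑≡sum (λ i → sum (f i)) ⟩
    sum (λ i → sum (f i))            ≈⟨ sum-comm f ⟩
    sum (λ j → sum (λ i → f i j))    ≡⟨ ∑≡sum (λ j → sum (λ i → f i j)) ⟨
    ∑ (λ j → sum (λ i → f i j))      ≈⟨ ∑-cong (λ j → reflexive (∑≡sum (flip f j))) ⟨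
    ∑ (λ j → ∑ (λ i → f i j))        ∎

  ∑-neg : ∀ {k} (f : Fin k → Carrier) → ∑ (λ i → - f i) ≈ - ∑ f
  ∑-neg {zero}  f = sym -0#≈0#
  ∑-neg {suc k} f = trans (+-congˡ (∑-neg (f ∘ suc))) (-‿+-comm _ _)

  0ₘ : ∀ {p q} → Matrix p q
  0ₘ _ _ = 0#

  -ₘ_ : ∀ {p q} → Matrix p q → Matrix p q
  (-ₘ M) i j = - M i j

  _-ₘ_ : ∀ {p q} → Matrix p q → Matrix p q → Matrix p q
  (M -ₘ N) i j = M i j - N i j

  ZeroRow : ∀ {p q} → Matrix p q → Fin p → Set ℓ
  ZeroRow M i = ∀ j → M i j ≈ 0#

  module _ {p q r : ℕ} where

    ⊗-congˡ : (M : Matrix p q) {N N′ : Matrix q r} → N ≈ₘ N′ → (M ⊗ N) ≈ₘ (M ⊗ N′)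
    ⊗-congˡ M N≈N′ i j = ∑-cong (λ t → *-congˡ (N≈N′ t j))

    ⊗-congʳ : {M M′ : Matrix p q} (N : Matrix q r) → M ≈ₘ M′ → (M ⊗ N) ≈ₘ (M′ ⊗ N)
    ⊗-congʳ N M≈M′ i j = ∑-cong (λ t → *-congʳ (M≈M′ i t))

    ⊗-zeroʳ : (M : Matrix p q) → (M ⊗ 0ₘ {q} {r}) ≈ₘ 0ₘ
    ⊗-zeroʳ M i j = ∑-zero (λ t → zeroʳ (M i t))

    ⊗-zeroRow : (M : Matrix p q) (N : Matrix q r) → ∀ i → ZeroRow M i → ZeroRow (M ⊗ N) i
    ⊗-zeroRow M N i Mi≈0 j = ∑-zero (λ t → trans (*-congʳ (Mi≈0 t)) (zeroˡ (N t j)))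

    ᵀ-anti-homo-⊗ : (M : Matrix p q) (N : Matrix q r) → ((M ⊗ N) ᵀ) ≈ₘ ((N ᵀ) ⊗ (M ᵀ))
    ᵀ-anti-homo-⊗ M N i j = ∑-cong (λ t → *-comm (M j t) (N t i))

    -ₘ‿distribʳ-⊗ : (M : Matrix p q) (N : Matrix q r) → (-ₘ (M ⊗ N)) ≈ₘ (M ⊗ (-ₘ N))
    -ₘ‿distribʳ-⊗ M N i j = trans (sym (∑-neg (λ t → M i t * N t j)))
                                  (∑-cong (λ t → -‿distribʳ-* (M i t) (N t j)))

    [M-N]O≈MO-NO : (M N : Matrix p q) (O : Matrix q r) →
                   ((M -ₘ N) ⊗ O) ≈ₘ ((M ⊗ O) -ₘ (N ⊗ O))
    [M-N]O≈MO-NO M N O i j = begin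
      ∑ (λ t → (M i t - N i t) * O t j)
        ≈⟨ ∑-cong (λ t → [y-z]x≈yx-zx (O t j) (M i t) (N i t)) ⟩
      ∑ (λ t → M i t * O t j - N i t * O t j)
        ≈⟨ ∑-distrib-+ (λ t → M i t * O t j) (λ t → - (N i t * O t j)) ⟩
      (M ⊗ O) i j + ∑ (λ t → - (N i t * O t j))
        ≈⟨ +-congˡ (∑-neg (λ t → N i t * O t j)) ⟩
      (M ⊗ O) i j - (N ⊗ O) i j
        ∎

  ⊗-assoc : ∀ {p q r s} (M : Matrix p q) (N : Matrix q r) (O : Matrix r s) →
            ((M ⊗ N) ⊗ O) ≈ₘ (M ⊗ (N ⊗ O))
  ⊗-assoc M N O i j = begin
    ∑ (λ t → ∑ (λ u → M i u * N u t) * O t j)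
      ≈⟨ ∑-cong (λ t → *-distribʳ-∑ (O t j) (λ u → M i u * N u t)) ⟩
    ∑ (λ t → ∑ (λ u → (M i u * N u t) * O t j))
      ≈⟨ ∑-comm (λ t u → (M i u * N u t) * O t j) ⟩
    ∑ (λ u → ∑ (λ t → (M i u * N u t) * O t j))
      ≈⟨ ∑-cong (λ u → ∑-cong (λ t → *-assoc (M i u) (N u t) (O t j))) ⟩
    ∑ (λ u → ∑ (λ t → M i u * (N u t * O t j)))
      ≈⟨ ∑-cong (λ u → *-distribˡ-∑ (M i u) (λ t → N u t * O t j)) ⟨
    ∑ (λ u → M i u * ∑ (λ t → N u t * O t j))
      ∎

  ⊗-identityˡ : ∀ {p q} (M : Matrix p q) → (Id ⊗ M) ≈ₘ M
  ⊗-identityˡ {suc p} M zero j = begin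
    1# * M zero j + ∑ (λ t → 0# * M (suc t) j)
      ≈⟨ +-cong (*-identityˡ (M zero j)) (∑-zero (λ t → zeroˡ (M (suc t) j))) ⟩
    M zero j + 0#
      ≈⟨ +-identityʳ (M zero j) ⟩
    M zero j
      ∎
  ⊗-identityˡ {suc p} M (suc i) j = begin
    0# * M zero j + (Id ⊗ (M ∘ suc)) i j
      ≈⟨ +-cong (zeroˡ (M zero j)) (⊗-identityˡ (M ∘ suc) i j) ⟩
    0# + M (suc i) j
      ≈⟨ +-identityˡ (M (suc i) j) ⟩
    M (suc i) j
      ∎

  -- SNIP i M is definitionally StrongProperty (_≢ i) M.
  StrongProperty : ∀ {n} → (Fin n → Set) → Matrix n n → Set (c ⊔ ℓ)
  StrongProperty {n} R M = (X : Matrix n n) → Symmetric X →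
    (∀ p q → M p q * X p q ≈ 0#) →
    (∀ p → X p p ≈ 0#) →
    (∀ p q → R p → (M ⊗ X) p q ≈ 0#) →
    ∀ p q → X p q ≈ 0#

  module _ {n} {M : Matrix n n} where

    SAP⇒StrongProperty : SAP M → StrongProperty (λ _ → ⊤) M
    SAP⇒StrongProperty sap X X-sym M∘X≈0 X-diag MX≈0 =
      sap X X-sym M∘X≈0 X-diag (λ p q → MX≈0 p q tt)

    StrongProperty⇒SAP : StrongProperty (λ _ → ⊤) M → SAP M
    StrongProperty⇒SAP strong X X-sym M∘X≈0 X-diag MX≈0 =
      strong X X-sym M∘X≈0 X-diag (λ p q _ → MX≈0 p q)

    StrongProperty-mono : ∀ {R₁ R₂ : Fin n → Set} → (∀ p → R₁ p → R₂ p) →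
                          StrongProperty R₁ M → StrongProperty R₂ M
    StrongProperty-mono R₁⊆R₂ strong X X-sym M∘X≈0 X-diag MX≈0 =
      strong X X-sym M∘X≈0 X-diag (λ p q → MX≈0 p q ∘ R₁⊆R₂ p)

  ∑-splitAt : ∀ k {m} (g : Fin k ⊎ Fin m → Carrier) →
              ∑ (g ∘ splitAt k) ≈ ∑ (g ∘ inj₁) + ∑ (g ∘ inj₂)
  ∑-splitAt zero    g = sym (+-identityˡ _)
  ∑-splitAt (suc k) g = trans (+-congˡ (∑-splitAt k (g ∘ map₁ suc))) (sym (+-assoc _ _ _))

  module _ {n k m} (split : Partition n k m) where
    open Partition split

    ∑-partition : (f : Fin n → Carrier) → ∑ f ≈ ∑ (f ∘ ι) + ∑ (f ∘ κ)
    ∑-partition f = begin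
      ∑ f                          ≡⟨ ∑≡sum f ⟩
      sum f                        ≈⟨ sum-permute f ⊎-permutation ⟩
      sum (f ∘ embed ∘ splitAt k)  ≡⟨ ∑≡sum (f ∘ embed ∘ splitAt k) ⟨
      ∑ (f ∘ embed ∘ splitAt k)    ≈⟨ ∑-splitAt k (f ∘ embed) ⟩
      ∑ (f ∘ ι) + ∑ (f ∘ κ)        ∎

    module Extension
      (A : Matrix n n) (A-sym : Symmetric A)
      (Q′ : Matrix k k) (QQ′≈I : (sub A ι ι ⊗ Q′) ≈ₘ Id)
      (X : Matrix m m) (X-sym : Symmetric X) (X-diag : ∀ b → X b b ≈ 0#)
      (S∘X≈0 : ∀ b b′ → schur A ι κ Q′ b b′ * X b b′ ≈ 0#)
      (BBX≈0 : ∀ a a′ b b′ → (A (ι a) (κ b) * A (ι a′) (κ b′)) * X b b′ ≈ 0#)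
      where

      Q : Matrix k k
      Q = sub A ι ι

      B : Matrix m k
      B = sub A κ ι

      Bᵀ : Matrix k m
      Bᵀ = sub A ι κ

      C : Matrix m m
      C = sub A κ κ

      D : Matrix m m
      D = (B ⊗ Q′) ⊗ Bᵀ

      S : Matrix m m
      S = schur A ι κ Q′

      W : Matrix k m
      W = Q′ ⊗ (Bᵀ ⊗ X)

      Bᵀ∘BᵀX≈0 : ∀ a a′ b → Bᵀ a b * (Bᵀ ⊗ X) a′ b ≈ 0#
      Bᵀ∘BᵀX≈0 a a′ b = begin
        Bᵀ a b * (Bᵀ ⊗ X) a′ b
          ≈⟨ *-distribˡ-∑ (Bᵀ a b) (λ b′ → Bᵀ a′ b′ * X b′ b) ⟩
        ∑ (λ b′ → Bᵀ a b * (Bᵀ a′ b′ * X b′ b))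
          ≈⟨ ∑-zero term≈0 ⟩
        0#
          ∎
        where
        term≈0 : ∀ b′ → Bᵀ a b * (Bᵀ a′ b′ * X b′ b) ≈ 0#
        term≈0 b′ = trans (x∙yz≈yx∙z (Bᵀ a b) (Bᵀ a′ b′) (X b′ b)) (BBX≈0 a′ a b′ b)

      Bᵀ∘W≈0 : ∀ a a′ b → Bᵀ a b * W a′ b ≈ 0#
      Bᵀ∘W≈0 a a′ b = begin
        Bᵀ a b * W a′ b
          ≈⟨ *-distribˡ-∑ (Bᵀ a b) (λ a″ → Q′ a′ a″ * (Bᵀ ⊗ X) a″ b) ⟩
        ∑ (λ a″ → Bᵀ a b * (Q′ a′ a″ * (Bᵀ ⊗ X) a″ b))
          ≈⟨ ∑-zero term≈0 ⟩
        0#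
          ∎
        where
        term≈0 : ∀ a″ → Bᵀ a b * (Q′ a′ a″ * (Bᵀ ⊗ X) a″ b) ≈ 0#
        term≈0 a″ = begin
          Bᵀ a b * (Q′ a′ a″ * (Bᵀ ⊗ X) a″ b)  ≈⟨ x∙yz≈y∙xz (Bᵀ a b) (Q′ a′ a″) _ ⟩
          Q′ a′ a″ * (Bᵀ a b * (Bᵀ ⊗ X) a″ b)  ≈⟨ *-congˡ (Bᵀ∘BᵀX≈0 a a″ b) ⟩
          Q′ a′ a″ * 0#                        ≈⟨ zeroʳ (Q′ a′ a″) ⟩
          0#                                   ∎

      Bᵀ∘-W≈0 : ∀ a a′ b → Bᵀ a b * - W a′ b ≈ 0#
      Bᵀ∘-W≈0 a a′ b = trans (sym (-‿distribʳ-* (Bᵀ a b) (W a′ b))) (-‿≈0 (Bᵀ∘W≈0 a a′ b))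

      BᵀXB≈0 : (Bᵀ ⊗ (X ⊗ B)) ≈ₘ 0ₘ
      BᵀXB≈0 a a′ = ∑-zero λ b →
        trans (*-distribˡ-∑ (Bᵀ a b) (λ b′ → X b b′ * B b′ a′)) (∑-zero (term≈0 b))
        where
        term≈0 : ∀ b b′ → Bᵀ a b * (X b b′ * B b′ a′) ≈ 0#
        term≈0 b b′ = begin
          Bᵀ a b * (X b b′ * B b′ a′)   ≈⟨ x∙yz≈xz∙y (Bᵀ a b) (X b b′) (B b′ a′) ⟩
          (Bᵀ a b * B b′ a′) * X b b′   ≈⟨ *-congʳ (*-congˡ (A-sym (κ b′) (ι a′))) ⟩
          (Bᵀ a b * Bᵀ a′ b′) * X b b′  ≈⟨ BBX≈0 a a′ b b′ ⟩
          0#                            ∎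

      D∘X≈0 : ∀ b b′ → D b b′ * X b b′ ≈ 0#
      D∘X≈0 b b′ =
        trans (*-distribʳ-∑ (X b b′) (λ a′ → (B ⊗ Q′) b a′ * Bᵀ a′ b′)) (∑-zero term≈0)
        where
        BQ∘BᵀX≈0 : ∀ a′ a → (B b a * Q′ a a′) * (Bᵀ a′ b′ * X b b′) ≈ 0#
        BQ∘BᵀX≈0 a′ a = begin
          (B b a * Q′ a a′) * (Bᵀ a′ b′ * X b b′)   ≈⟨ xy∙z≈y∙xz (B b a) (Q′ a a′) _ ⟩
          Q′ a a′ * (B b a * (Bᵀ a′ b′ * X b b′))   ≈⟨ *-congˡ (*-assoc _ _ _) ⟨
          Q′ a a′ * ((B b a * Bᵀ a′ b′) * X b b′)   ≈⟨ *-congˡ (*-congʳ (*-congʳ (A-sym _ _))) ⟩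
          Q′ a a′ * ((Bᵀ a b * Bᵀ a′ b′) * X b b′)  ≈⟨ *-congˡ (BBX≈0 a a′ b b′) ⟩
          Q′ a a′ * 0#                              ≈⟨ zeroʳ (Q′ a a′) ⟩
          0#                                        ∎
        term≈0 : ∀ a′ → ((B ⊗ Q′) b a′ * Bᵀ a′ b′) * X b b′ ≈ 0#
        term≈0 a′ = begin
          ((B ⊗ Q′) b a′ * Bᵀ a′ b′) * X b b′
            ≈⟨ *-assoc ((B ⊗ Q′) b a′) (Bᵀ a′ b′) (X b b′) ⟩
          (B ⊗ Q′) b a′ * (Bᵀ a′ b′ * X b b′)
            ≈⟨ *-distribʳ-∑ (Bᵀ a′ b′ * X b b′) (λ a → B b a * Q′ a a′) ⟩
          ∑ (λ a → (B b a * Q′ a a′) * (Bᵀ a′ b′ * X b b′))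
            ≈⟨ ∑-zero (BQ∘BᵀX≈0 a′) ⟩
          0#
            ∎

      C∘X≈0 : ∀ b b′ → C b b′ * X b b′ ≈ 0#
      C∘X≈0 b b′ = begin
        C b b′ * X b b′                      ≈⟨ *-congʳ (//-rightDividesˡ (D b b′) (C b b′)) ⟨
        (S b b′ + D b b′) * X b b′           ≈⟨ distribʳ (X b b′) (S b b′) (D b b′) ⟩
        S b b′ * X b b′ + D b b′ * X b b′    ≈⟨ +-cong (S∘X≈0 b b′) (D∘X≈0 b b′) ⟩
        0# + 0#                              ≈⟨ +-identityˡ 0# ⟩
        0#                                   ∎

      QW≈BᵀX : (Q ⊗ W) ≈ₘ (Bᵀ ⊗ X)
      QW≈BᵀX i j = begin
        (Q ⊗ (Q′ ⊗ (Bᵀ ⊗ X))) i j  ≈⟨ ⊗-assoc Q Q′ (Bᵀ ⊗ X) i j ⟨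
        ((Q ⊗ Q′) ⊗ (Bᵀ ⊗ X)) i j  ≈⟨ ⊗-congʳ (Bᵀ ⊗ X) QQ′≈I i j ⟩
        (Id ⊗ (Bᵀ ⊗ X)) i j        ≈⟨ ⊗-identityˡ (Bᵀ ⊗ X) i j ⟩
        (Bᵀ ⊗ X) i j               ∎

      BW≈DX : (B ⊗ W) ≈ₘ (D ⊗ X)
      BW≈DX i j = begin
        (B ⊗ (Q′ ⊗ (Bᵀ ⊗ X))) i j  ≈⟨ ⊗-assoc B Q′ (Bᵀ ⊗ X) i j ⟨
        ((B ⊗ Q′) ⊗ (Bᵀ ⊗ X)) i j  ≈⟨ ⊗-assoc (B ⊗ Q′) Bᵀ X i j ⟨
        (D ⊗ X) i j                ∎

      Wᵀ≈XBQ′ᵀ : (W ᵀ) ≈ₘ ((X ⊗ B) ⊗ (Q′ ᵀ))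
      Wᵀ≈XBQ′ᵀ i j = trans (ᵀ-anti-homo-⊗ Q′ (Bᵀ ⊗ X) i j) (⊗-congʳ (Q′ ᵀ) [BᵀX]ᵀ≈XB i j)
        where
        [BᵀX]ᵀ≈XB : ((Bᵀ ⊗ X) ᵀ) ≈ₘ (X ⊗ B)
        [BᵀX]ᵀ≈XB b a = ∑-cong λ t →
          trans (*-comm (Bᵀ a t) (X t b)) (*-cong (X-sym t b) (A-sym (ι a) (κ t)))

      CXB≈SXB : (C ⊗ (X ⊗ B)) ≈ₘ (S ⊗ (X ⊗ B))
      CXB≈SXB i j = sym (begin
        (S ⊗ (X ⊗ B)) i j                          ≈⟨ [M-N]O≈MO-NO C D (X ⊗ B) i j ⟩
        (C ⊗ (X ⊗ B)) i j - (D ⊗ (X ⊗ B)) i j      ≈⟨ +-congˡ (-‿≈0 DXB≈0) ⟩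
        (C ⊗ (X ⊗ B)) i j + 0#                     ≈⟨ +-identityʳ _ ⟩
        (C ⊗ (X ⊗ B)) i j                          ∎)
        where
        DXB≈0 : (D ⊗ (X ⊗ B)) i j ≈ 0#
        DXB≈0 = begin
          (((B ⊗ Q′) ⊗ Bᵀ) ⊗ (X ⊗ B)) i j  ≈⟨ ⊗-assoc (B ⊗ Q′) Bᵀ (X ⊗ B) i j ⟩
          ((B ⊗ Q′) ⊗ (Bᵀ ⊗ (X ⊗ B))) i j  ≈⟨ ⊗-congˡ (B ⊗ Q′) BᵀXB≈0 i j ⟩
          ((B ⊗ Q′) ⊗ 0ₘ) i j              ≈⟨ ⊗-zeroʳ (B ⊗ Q′) i j ⟩
          0#                               ∎

      CWᵀ-zeroRow : ∀ b → ZeroRow (S ⊗ X) b → ZeroRow (C ⊗ (W ᵀ)) b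
      CWᵀ-zeroRow b SX-row j = begin
        (C ⊗ (W ᵀ)) b j               ≈⟨ ⊗-congˡ C Wᵀ≈XBQ′ᵀ b j ⟩
        (C ⊗ ((X ⊗ B) ⊗ Q′ᵀ)) b j     ≈⟨ ⊗-assoc C (X ⊗ B) Q′ᵀ b j ⟨
        ((C ⊗ (X ⊗ B)) ⊗ Q′ᵀ) b j     ≈⟨ ⊗-congʳ Q′ᵀ CXB≈SXB b j ⟩
        ((S ⊗ (X ⊗ B)) ⊗ Q′ᵀ) b j     ≈⟨ ⊗-congʳ Q′ᵀ (λ i j → sym (⊗-assoc S X B i j)) b j ⟩
        (((S ⊗ X) ⊗ B) ⊗ Q′ᵀ) b j     ≈⟨ ⊗-zeroRow ((S ⊗ X) ⊗ B) Q′ᵀ b SXB-row j ⟩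
        0#                            ∎
        where
        Q′ᵀ : Matrix k k
        Q′ᵀ = Q′ ᵀ
        SXB-row : ZeroRow ((S ⊗ X) ⊗ B) b
        SXB-row = ⊗-zeroRow (S ⊗ X) B b SX-row

      AY₁₁≈0 : ∀ a a′ → (Q ⊗ 0ₘ) a a′ + (Bᵀ ⊗ (-ₘ (W ᵀ))) a a′ ≈ 0#
      AY₁₁≈0 a a′ = trans (+-cong (⊗-zeroʳ Q a a′) (∑-zero (Bᵀ∘-W≈0 a a′))) (+-identityˡ 0#)

      AY₁₂≈0 : ∀ a b′ → (Q ⊗ (-ₘ W)) a b′ + (Bᵀ ⊗ X) a b′ ≈ 0#
      AY₁₂≈0 a b′ = begin
        (Q ⊗ (-ₘ W)) a b′ + (Bᵀ ⊗ X) a b′    ≈⟨ +-congʳ (-ₘ‿distribʳ-⊗ Q W a b′) ⟨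
        - (Q ⊗ W) a b′ + (Bᵀ ⊗ X) a b′       ≈⟨ +-congʳ (-‿cong (QW≈BᵀX a b′)) ⟩
        - (Bᵀ ⊗ X) a b′ + (Bᵀ ⊗ X) a b′      ≈⟨ -‿inverseˡ ((Bᵀ ⊗ X) a b′) ⟩
        0#                                   ∎

      AY₂₁≈0 : ∀ b → ZeroRow (S ⊗ X) b →
               ∀ a′ → (B ⊗ 0ₘ) b a′ + (C ⊗ (-ₘ (W ᵀ))) b a′ ≈ 0#
      AY₂₁≈0 b SX-row a′ = trans (+-cong (⊗-zeroʳ B b a′) CWᵀ≈0) (+-identityˡ 0#)
        where
        CWᵀ≈0 : (C ⊗ (-ₘ (W ᵀ))) b a′ ≈ 0#
        CWᵀ≈0 = trans (sym (-ₘ‿distribʳ-⊗ C (W ᵀ) b a′)) (-‿≈0 (CWᵀ-zeroRow b SX-row a′))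

      AY₂₂≈SX : ∀ b b′ → (B ⊗ (-ₘ W)) b b′ + (C ⊗ X) b b′ ≈ (S ⊗ X) b b′
      AY₂₂≈SX b b′ = begin
        (B ⊗ (-ₘ W)) b b′ + (C ⊗ X) b b′     ≈⟨ +-congʳ (-ₘ‿distribʳ-⊗ B W b b′) ⟨
        - (B ⊗ W) b b′ + (C ⊗ X) b b′        ≈⟨ +-congʳ (-‿cong (BW≈DX b b′)) ⟩
        - (D ⊗ X) b b′ + (C ⊗ X) b b′        ≈⟨ +-comm _ _ ⟩
        (C ⊗ X) b b′ - (D ⊗ X) b b′          ≈⟨ [M-N]O≈MO-NO C D X b b′ ⟨
        (S ⊗ X) b b′                         ∎

      Yᵇ : Fin k ⊎ Fin m → Fin k ⊎ Fin m → Carrier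
      Yᵇ (inj₁ a) (inj₁ a′) = 0#
      Yᵇ (inj₁ a) (inj₂ b)  = - W a b
      Yᵇ (inj₂ b) (inj₁ a)  = - W a b
      Yᵇ (inj₂ b) (inj₂ b′) = X b b′

      Y : Matrix n n
      Y u v = Yᵇ (classify u) (classify v)

      Y-embed : ∀ s t → Y (embed s) (embed t) ≡ Yᵇ s t
      Y-embed s t = ≡.cong₂ Yᵇ (classify-embed s) (classify-embed t)

      Y-sym : Symmetric Y
      Y-sym u v = Yᵇ-sym (classify u) (classify v)
        where
        Yᵇ-sym : ∀ s t → Yᵇ s t ≈ Yᵇ t s
        Yᵇ-sym (inj₁ a) (inj₁ a′) = refl
        Yᵇ-sym (inj₁ a) (inj₂ b)  = refl
        Yᵇ-sym (inj₂ b) (inj₁ a)  = refl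
        Yᵇ-sym (inj₂ b) (inj₂ b′) = X-sym b b′

      Y-diag : ∀ u → Y u u ≈ 0#
      Y-diag u = Yᵇ-diag (classify u)
        where
        Yᵇ-diag : ∀ s → Yᵇ s s ≈ 0#
        Yᵇ-diag (inj₁ a) = refl
        Yᵇ-diag (inj₂ b) = X-diag b

      A∘Y≈0 : ∀ u v → A u v * Y u v ≈ 0#
      A∘Y≈0 = ∀-embed₂ λ s t → trans (*-congˡ (reflexive (Y-embed s t))) (A∘Yᵇ≈0 s t)
        where
        A∘Yᵇ≈0 : ∀ s t → A (embed s) (embed t) * Yᵇ s t ≈ 0#
        A∘Yᵇ≈0 (inj₁ a) (inj₁ a′) = zeroʳ (Q a a′)
        A∘Yᵇ≈0 (inj₁ a) (inj₂ b)  = Bᵀ∘-W≈0 a a b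
        A∘Yᵇ≈0 (inj₂ b) (inj₁ a)  = trans (*-congʳ (A-sym (κ b) (ι a))) (Bᵀ∘-W≈0 a a b)
        A∘Yᵇ≈0 (inj₂ b) (inj₂ b′) = C∘X≈0 b b′

      AY-embed : ∀ s t → (A ⊗ Y) (embed s) (embed t) ≈
                 ∑ (λ a → A (embed s) (ι a) * Yᵇ (inj₁ a) t) +
                 ∑ (λ b → A (embed s) (κ b) * Yᵇ (inj₂ b) t)
      AY-embed s t = trans (∑-partition (λ w → A (embed s) w * Y w (embed t)))
        (+-cong (∑-cong λ a → *-congˡ (reflexive (Y-embed (inj₁ a) t)))
                (∑-cong λ b → *-congˡ (reflexive (Y-embed (inj₂ b) t))))

      AY-zeroRows : (R : Fin n → Set) → (∀ b → R (κ b) → ZeroRow (S ⊗ X) b) →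
                    ∀ u v → R u → (A ⊗ Y) u v ≈ 0#
      AY-zeroRows R SX-rows = ∀-embed₂ λ s t Rs → trans (AY-embed s t) (AY-block s t Rs)
        where
        AY-block : ∀ s t → R (embed s) →
                   ∑ (λ a → A (embed s) (ι a) * Yᵇ (inj₁ a) t) +
                   ∑ (λ b → A (embed s) (κ b) * Yᵇ (inj₂ b) t) ≈ 0#
        AY-block (inj₁ a) (inj₁ a′) _  = AY₁₁≈0 a a′
        AY-block (inj₁ a) (inj₂ b′) _  = AY₁₂≈0 a b′
        AY-block (inj₂ b) (inj₁ a′) Rb = AY₂₁≈0 b (SX-rows b Rb) a′
        AY-block (inj₂ b) (inj₂ b′) Rb = trans (AY₂₂≈SX b b′) (SX-rows b Rb b′)

    clique⇒X-vanishes-on-N[α] :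
      (G : Graph n) (A : Matrix n n) → InS G A →
      (Q′ : Matrix k k) (H : Graph m) → InS H (schur A ι κ Q′) → NeighbourhoodIsClique G H →
      (X : Matrix m m) → (∀ b → X b b ≈ 0#) → (∀ b b′ → schur A ι κ Q′ b b′ * X b b′ ≈ 0#) →
      ∀ a a′ b b′ → A (ι a) (κ b) ≉ 0# → A (ι a′) (κ b′) ≉ 0# → X b b′ ≈ 0#
    clique⇒X-vanishes-on-N[α] G A (_ , A~G) Q′ H (_ , S~H) clique X X-diag S∘X≈0
                              a a′ b b′ A≉0 A′≉0 with b ≟ b′
    ... | yes ≡.refl = X-diag b
    ... | no b≢b′ = x*y≈0⇒y≈0 S≉0 (S∘X≈0 b b′)
      where
      neighbour : ∀ a b → A (ι a) (κ b) ≉ 0# → InN[α] G b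
      neighbour a b A≉0 = a , Equivalence.to (A~G (ι a) (κ b) (disjoint a b)) A≉0
      S≉0 : schur A ι κ Q′ b b′ ≉ 0#
      S≉0 = Equivalence.from (S~H b b′ b≢b′)
              (clique b b′ b≢b′ (neighbour a b A≉0) (neighbour a′ b′ A′≉0))

    schur-strongProperty :
      (G : Graph n) (A : Matrix n n) → InS G A →
      (Q′ : Matrix k k) → (sub A ι ι ⊗ Q′) ≈ₘ Id →
      (H : Graph m) → InS H (schur A ι κ Q′) → NeighbourhoodIsClique G H →
      ∀ {R} → StrongProperty R A → StrongProperty (R ∘ κ) (schur A ι κ Q′)
    schur-strongProperty G A A∈G Q′ QQ′≈I H S∈H clique {R} strongA
                         X X-sym S∘X≈0 X-diag SX≈0 b b′ =
      begin
        X b b′          ≡⟨ Y-embed (inj₂ b) (inj₂ b′) ⟨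
        Y (κ b) (κ b′)  ≈⟨ Y≈0 (κ b) (κ b′) ⟩
        0#              ∎
      where
      BBX≈0 : ∀ a a′ b b′ → (A (ι a) (κ b) * A (ι a′) (κ b′)) * X b b′ ≈ 0#
      BBX≈0 a a′ b b′ = x*y*z≈0
        (clique⇒X-vanishes-on-N[α] G A A∈G Q′ H S∈H clique X X-diag S∘X≈0 a a′ b b′)
      open Extension A (proj₁ A∈G) Q′ QQ′≈I X X-sym X-diag S∘X≈0 BBX≈0
      Y≈0 : ∀ u v → Y u v ≈ 0#
      Y≈0 = strongA Y Y-sym A∘Y≈0 Y-diag (AY-zeroRows R (λ b Rκb b′ → SX≈0 b b′ Rκb))

lemma5p2 : ∀ {c ℓ} (ℝ : CompleteOrderedField c ℓ) → let open LinAlg ℝ in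
    ∀ {n k m} (G : Graph n) (A : Matrix n n) → InS G A →
    -- α = image of ι, V(G) \ α = image of κ
    (ι : Fin k → Fin n) (κ : Fin m → Fin n) →
    Injective _≡_ _≡_ ι → Injective _≡_ _≡_ κ →
    (∀ a b → ι a ≢ κ b) →
    (∀ v → (∃ λ a → ι a ≡ v) ⊎ (∃ λ b → κ b ≡ v)) →
    -- A[α] invertible with inverse Q'
    (Q' : Matrix k k) → IsInverse (sub A ι ι) Q' →
    -- A / A[α] ∈ 𝒮(H), with N(α) a clique in H
    (H : Graph m) → InS H (schur A ι κ Q') →
    (∀ b b' → b ≢ b' →
      (∃ λ a → Graph.Adj G (ι a) (κ b)) →
      (∃ λ a → Graph.Adj G (ι a) (κ b')) →
      Graph.Adj H b b') →
    (SAP A → SAP (schur A ι κ Q')) ×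
    (∀ i → SNIP (κ i) A → SNIP i (schur A ι κ Q'))
lemma5p2 ℝ {n} {k} {m} G A A∈G ι κ ι-injective κ-injective disjoint cover
         Q′ (QQ′≈I , _) H S∈H clique =
    StrongProperty⇒SAP ℝ ∘ to-schur ∘ SAP⇒StrongProperty ℝ
  , λ i → StrongProperty-mono ℝ (λ b κb≢κi b≡i → κb≢κi (≡.cong κ b≡i)) ∘ to-schur
  where
  split : Partition n k m
  split = record
    { ι = ι ; κ = κ ; ι-injective = ι-injective ; κ-injective = κ-injective
    ; disjoint = disjoint ; cover = cover }

  to-schur : ∀ {R} → StrongProperty ℝ R A →
             StrongProperty ℝ (R ∘ κ) (LinAlg.schur ℝ A ι κ Q′)
  to-schur = schur-strongProperty ℝ split G A A∈G Q′ QQ′≈I H S∈H clique
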